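{- Let $G$ be a simple signed graph with degree matrix $D$, net degree matrix $D^{\pm}$, adjacency matrix $A$, net incidence matrix $M^{\pm}$, net Laplacian $L^{\pm}$ and signless net Laplacian $Q^{\pm}$, and let $L_{|G|}$ and $Q_{|G|}$ be the Laplacian and signless Laplacian matrices of the underlying unsigned graph $|G|$. Then (a) $Q^{\pm}=D^{\pm}+A=M^{\pm}(M^{\pm})^T$; (b) $L^{\pm}=D^{\pm}-A=N^{\pm}(N^{\pm})^T$ for any oriented net incidence matrix $N^{\pm}$ of $G$; (c) $Q_{|G|}=D+|A|=M^{\pm}(M^{\pm})^*$; (d) $L_{|G|}=D-|A|=N^{\pm}(N^{\pm})^*$ for any oriented net incidence matrix $N^{\pm}$ of $G$.
   Context: A simple signed graph $G$ consists of a simple graph on vertex set $\{1,\ldots,n\}$ with edges $e_1,\ldots,e_m$, together with a sign $\sigma(e)\in\{1,-1\}$ for each edge (positive if $1$, negative if $-1$). $A$ has $(i,j)$-entry $\sigma(\{i,j\})$ if $\{i,j\}$ is an edge and $0$ otherwise; $|A|$ is its entrywise absolute value (adjacency matrix of the underlying unsigned graph $|G|$). $D$ is the diagonal matrix of vertex degrees; $D^{\pm}$ is the diagonal matrix of net degrees (number of positive minus number of negative incident edges). $L^{\pm}=D^{\pm}-A$, $Q^{\pm}=D^{\pm}+A$. The net incidence matrix $M^{\pm}=[m_{i\ell}]$ is the $n\times m$ matrix (rows indexed by vertices, columns by edges) whose column $\ell$, for $e_\ell=\{i,j\}$, has exactly two nonzero entries $m_{i\ell}=m_{j\ell}$, equal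 to $1$ if $e_\ell$ is positive and to the imaginary unit $\mathrm{i}$ if $e_\ell$ is negative. An oriented net incidence matrix $N^{\pm}$ is obtained from $M^{\pm}$ by multiplying exactly one of the two nonzero entries of each column by $-1$. $X^T$ is the transpose and $X^*$ the conjugate transpose. -}

module Defs where

open import Data.Nat using (ℕ; zero; suc)
open import Data.Integer as ℤ using (ℤ; +_; ∣_∣)
open import Data.Fin using (Fin; zero; suc; _≟_)
open import Data.Bool using (Bool; true; false; if_then_else_; _∧_; _∨_; not)
open import Data.Maybe using (Maybe; just; nothing)
open import Data.Product using (Σ; _×_; _,_; proj₁; proj₂)
open import Data.Sum using (_⊎_)
open import Relation.Nullary using (¬_; does)
open import Relation.Binary.PropositionalEquality using (_≡_)

-- Gaussian integers ℤ[i] ⊂ ℂ : all matrices in the theorem have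
-- entries in {0, ±1, ±i} and their products have entries in ℤ[i].

record ℤ[i] : Set where
  constructor gi
  field
    re : ℤ
    im : ℤ
open ℤ[i] public

infixl 6 _⊕_
infixl 7 _⊛_

_⊕_ : ℤ[i] → ℤ[i] → ℤ[i]
(gi a b) ⊕ (gi c d) = gi (a ℤ.+ c) (b ℤ.+ d)

_⊛_ : ℤ[i] → ℤ[i] → ℤ[i]
(gi a b) ⊛ (gi c d) = gi (a ℤ.* c ℤ.- b ℤ.* d) (a ℤ.* d ℤ.+ b ℤ.* c)

⊖_ : ℤ[i] → ℤ[i]
⊖ (gi a b) = gi (ℤ.- a) (ℤ.- b)

conj : ℤ[i] → ℤ[i]
conj (gi a b) = gi a (ℤ.- b)

0ᵍ 1ᵍ iᵍ : ℤ[i]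
0ᵍ = gi (+ 0) (+ 0)
1ᵍ = gi (+ 1) (+ 0)
iᵍ = gi (+ 0) (+ 1)

ι : ℤ → ℤ[i]
ι a = gi a (+ 0)

ΣZ : ∀ {m} → (Fin m → ℤ) → ℤ
ΣZ {zero}  f = + 0
ΣZ {suc m} f = f zero ℤ.+ ΣZ (λ k → f (suc k))

ΣG : ∀ {m} → (Fin m → ℤ[i]) → ℤ[i]
ΣG {zero}  f = 0ᵍ
ΣG {suc m} f = f zero ⊕ ΣG (λ k → f (suc k))

Mat : Set → ℕ → ℕ → Set
Mat A r c = Fin r → Fin c → A

transpose : ∀ {A r c} → Mat A r c → Mat A c r
transpose X i j = X j i

conjTranspose : ∀ {r c} → Mat ℤ[i] r c → Mat ℤ[i] c r
conjTranspose X i j = conj (X j i)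

infixl 7 _·_
_·_ : ∀ {r k c} → Mat ℤ[i] r k → Mat ℤ[i] k c → Mat ℤ[i] r c
(X · Y) i j = ΣG (λ l → X i l ⊛ Y l j)

_+ᴹ_ _-ᴹ_ : ∀ {r c} → Mat ℤ r c → Mat ℤ r c → Mat ℤ r c
(X +ᴹ Y) i j = X i j ℤ.+ Y i j
(X -ᴹ Y) i j = X i j ℤ.- Y i j

ιᴹ : ∀ {r c} → Mat ℤ r c → Mat ℤ[i] r c
ιᴹ X i j = ι (X i j)

∣_∣ᴹ : ∀ {r c} → Mat ℤ r c → Mat ℤ r c
∣ X ∣ᴹ i j = + ∣ X i j ∣

diag : ∀ {n} → (Fin n → ℤ) → Mat ℤ n n
diag d i j = if does (i ≟ j) then d i else + 0

_≡ᴹ_ : ∀ {A r c} → Mat A r c → Mat A r c → Set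
X ≡ᴹ Y = ∀ i j → X i j ≡ Y i j

search : ∀ {m} → (Fin m → Bool) → Maybe (Fin m)
search {zero}  p = nothing
search {suc m} p with p zero
... | true  = just zero
... | false with search (λ k → p (suc k))
...   | just k  = just (suc k)
...   | nothing = nothing

record SimpleGraph (n m : ℕ) : Set where
  field
    end₁ end₂ : Fin m → Fin n
    loopless  : ∀ ℓ → ¬ (end₁ ℓ ≡ end₂ ℓ)
    noMulti   : ∀ ℓ ℓ' → (end₁ ℓ ≡ end₁ ℓ' × end₂ ℓ ≡ end₂ ℓ')
                       ⊎ (end₁ ℓ ≡ end₂ ℓ' × end₂ ℓ ≡ end₁ ℓ') → ℓ ≡ ℓ'

  incident : Fin n → Fin m → Bool
  incident v ℓ = does (v ≟ end₁ ℓ) ∨ does (v ≟ end₂ ℓ)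

  joins : Fin m → Fin n → Fin n → Bool
  joins ℓ i j = (does (i ≟ end₁ ℓ) ∧ does (j ≟ end₂ ℓ))
              ∨ (does (i ≟ end₂ ℓ) ∧ does (j ≟ end₁ ℓ))

  edge? : Fin n → Fin n → Maybe (Fin m)
  edge? i j = search (λ ℓ → joins ℓ i j)

  adj : Mat ℤ n n
  adj i j with edge? i j
  ... | just _  = + 1
  ... | nothing = + 0

  degree : Fin n → ℤ
  degree v = ΣZ (λ ℓ → if incident v ℓ then + 1 else + 0)

  degMat : Mat ℤ n n
  degMat = diag degree

  laplacian signlessLaplacian : Mat ℤ n n
  laplacian         = degMat -ᴹ adj
  signlessLaplacian = degMat +ᴹ adj

data Sign : Set where
  pos neg : Sign

sgn : Sign → ℤ
sgn pos = + 1
sgn neg = ℤ.- (+ 1)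

record SignedGraph (n m : ℕ) : Set where
  field
    graph : SimpleGraph n m
    σ     : Fin m → Sign
  open SimpleGraph graph public

  A : Mat ℤ n n
  A i j with edge? i j
  ... | just ℓ  = sgn (σ ℓ)
  ... | nothing = + 0

  D : Mat ℤ n n
  D = diag degree

  netDegree : Fin n → ℤ
  netDegree v = ΣZ (λ ℓ → if incident v ℓ then sgn (σ ℓ) else + 0)

  D± : Mat ℤ n n
  D± = diag netDegree

  L± Q± : Mat ℤ n n
  L± = D± -ᴹ A
  Q± = D± +ᴹ A

  entry : Fin m → ℤ[i]
  entry ℓ with σ ℓ
  ... | pos = 1ᵍ
  ... | neg = iᵍ

  M± : Mat ℤ[i] n m
  M± v ℓ = if incident v ℓ then entry ℓ else 0ᵍ

  IsOrientedNetIncidence : Mat ℤ[i] n m → Set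
  IsOrientedNetIncidence N =
    ∀ ℓ → Σ (Fin n) λ u → (u ≡ end₁ ℓ ⊎ u ≡ end₂ ℓ)
        × (∀ v → N v ℓ ≡ (if does (v ≟ u) then ⊖ M± v ℓ else M± v ℓ))

∣_∣ᴳ : ∀ {n m} → SignedGraph n m → SimpleGraph n m
∣ G ∣ᴳ = SignedGraph.graph G

-- A column of M± is zero except at the two endpoints of its edge, where both entries are 1 or i;
-- their product is σ(e) under transposition and 1 under conjugate transposition. Summing over the
-- edges at i gives the (net) degree on the diagonal; off the diagonal only the unique edge joining
-- i and j survives, giving A or |A|. Orienting negates exactly one endpoint entry per column, which
-- leaves the diagonal products unchanged and negates the product at the edge joining i ≠ j.
module Submission where

open import Defs
open import Data.Nat using (zero; suc)
open import Data.Integer using (ℤ; +_; -_; _+_; _-_; _*_)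
open import Data.Integer.Properties using (+-identityˡ; +-identityʳ; neg-involutive)
open import Data.Integer.Tactic.RingSolver using (solve-∀)
open import Data.Fin using (Fin; zero; suc; _≟_)
open import Data.Fin.Properties using (suc-injective)
open import Data.Bool using (Bool; true; false; if_then_else_; _∧_; _xor_)
open import Data.Bool.Properties using (∧-idem; xor-same)
open import Data.Maybe using (just; nothing; maybe′)
open import Data.Product using (_×_; _,_)
open import Data.Sum using (_⊎_; inj₁; inj₂)
open import Data.Empty using (⊥-elim)
open import Function using (_∘_)
open import Relation.Nullary using (¬_; does; yes; no)
open import Relation.Binary.PropositionalEquality
open ≡-Reasoning

⊛-zeroʳ : ∀ x → x ⊛ 0ᵍ ≡ 0ᵍ
⊛-zeroʳ (gi a b) = cong₂ gi (re-part a b) (im-part a b)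
  where
  re-part : ∀ a b → a * + 0 - b * + 0 ≡ + 0
  re-part = solve-∀
  im-part : ∀ a b → a * + 0 + b * + 0 ≡ + 0
  im-part = solve-∀

⊖-⊛ : ∀ x y → ⊖ x ⊛ y ≡ ⊖ (x ⊛ y)
⊖-⊛ (gi a b) (gi c d) = cong₂ gi (re-part a b c d) (im-part a b c d)
  where
  re-part : ∀ a b c d → (- a) * c - (- b) * d ≡ - (a * c - b * d)
  re-part = solve-∀
  im-part : ∀ a b c d → (- a) * d + (- b) * c ≡ - (a * d + b * c)
  im-part = solve-∀

⊛-⊖ : ∀ x y → x ⊛ ⊖ y ≡ ⊖ (x ⊛ y)
⊛-⊖ (gi a b) (gi c d) = cong₂ gi (re-part a b c d) (im-part a b c d)
  where
  re-part : ∀ a b c d → a * (- c) - b * (- d) ≡ - (a * c - b * d)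
  re-part = solve-∀
  im-part : ∀ a b c d → a * (- d) + b * (- c) ≡ - (a * d + b * c)
  im-part = solve-∀

⊖-involutive : ∀ x → ⊖ ⊖ x ≡ x
⊖-involutive (gi a b) = cong₂ gi (neg-involutive a) (neg-involutive b)

negateIf : Bool → ℤ[i] → ℤ[i]
negateIf b x = if b then ⊖ x else x

negateIf-0ᵍ : ∀ b → negateIf b 0ᵍ ≡ 0ᵍ
negateIf-0ᵍ true  = refl
negateIf-0ᵍ false = refl

ΣG-ι : ∀ {m} {f : Fin m → ℤ[i]} {h : Fin m → ℤ} →
       (∀ k → f k ≡ ι (h k)) → ΣG f ≡ ι (ΣZ h)
ΣG-ι {zero}  eq = refl
ΣG-ι {suc m} eq = cong₂ _⊕_ (eq zero) (ΣG-ι (eq ∘ suc))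

ΣZ-zero : ∀ {m} {h : Fin m → ℤ} → (∀ k → h k ≡ + 0) → ΣZ h ≡ + 0
ΣZ-zero {zero}  eq = refl
ΣZ-zero {suc m} eq = cong₂ _+_ (eq zero) (ΣZ-zero (eq ∘ suc))

ΣZ-search : ∀ {m} (p : Fin m → Bool) (w : Fin m → ℤ) →
            (∀ k k′ → p k ≡ true → p k′ ≡ true → k ≡ k′) →
            ΣZ (λ k → if p k then w k else + 0) ≡ maybe′ w (+ 0) (search p)
ΣZ-search {zero}  p w unique = refl
ΣZ-search {suc m} p w unique with p zero in p0
... | true = trans (cong (λ s → w zero + s) (ΣZ-zero rest-vanishes)) (+-identityʳ (w zero))
  where
  rest-vanishes : ∀ k → (if p (suc k) then w (suc k) else + 0) ≡ + 0
  rest-vanishes k with p (suc k) in pk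
  ... | true  with () ← unique (suc k) zero pk p0
  ... | false = refl
... | false with search (p ∘ suc)
               | ΣZ-search (p ∘ suc) (w ∘ suc)
                           (λ k k′ pk pk′ → suc-injective (unique (suc k) (suc k′) pk pk′))
...   | just k  | sum-rest = trans (+-identityˡ _) sum-rest
...   | nothing | sum-rest = trans (+-identityˡ _) sum-rest

exactly-one-equal : ∀ {n} {i j u : Fin n} → ¬ i ≡ j → u ≡ i ⊎ u ≡ j →
                    (does (i ≟ u) xor does (j ≟ u)) ≡ true
exactly-one-equal {i = i} {j} {u} i≢j u-end with i ≟ u | j ≟ u | u-end
... | yes p | yes q | _      = ⊥-elim (i≢j (trans p (sym q)))
... | yes _ | no _  | _      = refl
... | no _  | yes _ | _      = refl
... | no ¬p | no _  | inj₁ r = ⊥-elim (¬p (sym r))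
... | no _  | no ¬q | inj₂ r = ⊥-elim (¬q (sym r))

module _ {n m} (g : SimpleGraph n m) where
  open SimpleGraph g

  weightedDegree : (Fin m → ℤ) → Fin n → ℤ
  weightedDegree w v = ΣZ (λ ℓ → if incident v ℓ then w ℓ else + 0)

  weightedAdj : (Fin m → ℤ) → Mat ℤ n n
  weightedAdj w i j = maybe′ w (+ 0) (edge? i j)

  joins⇒endpoints : ∀ ℓ i j → joins ℓ i j ≡ true →
                    (i ≡ end₁ ℓ × j ≡ end₂ ℓ) ⊎ (i ≡ end₂ ℓ × j ≡ end₁ ℓ)
  joins⇒endpoints ℓ i j e
    with i ≟ end₁ ℓ | j ≟ end₂ ℓ | i ≟ end₂ ℓ | j ≟ end₁ ℓ
  ... | yes p | yes q | _     | _     = inj₁ (p , q)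
  ... | yes _ | no _  | yes r | yes s = inj₂ (r , s)
  ... | no _  | _     | yes r | yes s = inj₂ (r , s)
  ... | yes _ | no _  | yes _ | no _  with () ← e
  ... | yes _ | no _  | no _  | _     with () ← e
  ... | no _  | _     | yes _ | no _  with () ← e
  ... | no _  | _     | no _  | _     with () ← e

  joins-unique : ∀ i j ℓ ℓ′ → joins ℓ i j ≡ true → joins ℓ′ i j ≡ true → ℓ ≡ ℓ′
  joins-unique i j ℓ ℓ′ e e′ with joins⇒endpoints ℓ i j e | joins⇒endpoints ℓ′ i j e′
  ... | inj₁ (p , q) | inj₁ (p′ , q′) = noMulti ℓ ℓ′ (inj₁ (trans (sym p) p′ , trans (sym q) q′))
  ... | inj₁ (p , q) | inj₂ (p′ , q′) = noMulti ℓ ℓ′ (inj₂ (trans (sym p) p′ , trans (sym q) q′))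
  ... | inj₂ (p , q) | inj₁ (p′ , q′) = noMulti ℓ ℓ′ (inj₂ (trans (sym q) q′ , trans (sym p) p′))
  ... | inj₂ (p , q) | inj₂ (p′ , q′) = noMulti ℓ ℓ′ (inj₁ (trans (sym q) q′ , trans (sym p) p′))

  joins-irrefl : ∀ ℓ i → joins ℓ i i ≡ false
  joins-irrefl ℓ i with i ≟ end₁ ℓ | i ≟ end₂ ℓ
  ... | yes p | yes q = ⊥-elim (loopless ℓ (trans (sym p) q))
  ... | yes _ | no _  = refl
  ... | no _  | yes _ = refl
  ... | no _  | no _  = refl

  incident∧incident≡joins : ∀ {i j} ℓ → ¬ i ≡ j → (incident i ℓ ∧ incident j ℓ) ≡ joins ℓ i j
  incident∧incident≡joins {i} {j} ℓ i≢j
    with i ≟ end₁ ℓ | i ≟ end₂ ℓ | j ≟ end₁ ℓ | j ≟ end₂ ℓ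
  ... | yes p | yes q | _     | _     = ⊥-elim (loopless ℓ (trans (sym p) q))
  ... | _     | _     | yes p | yes q = ⊥-elim (loopless ℓ (trans (sym p) q))
  ... | yes p | _     | yes q | _     = ⊥-elim (i≢j (trans p (sym q)))
  ... | _     | yes p | _     | yes q = ⊥-elim (i≢j (trans p (sym q)))
  ... | yes _ | no _  | no _  | yes _ = refl
  ... | yes _ | no _  | no _  | no _  = refl
  ... | no _  | yes _ | yes _ | no _  = refl
  ... | no _  | yes _ | no _  | no _  = refl
  ... | no _  | no _  | yes _ | no _  = refl
  ... | no _  | no _  | no _  | yes _ = refl
  ... | no _  | no _  | no _  | no _  = refl

  ΣZ-joins : ∀ w i j → ΣZ (λ ℓ → if joins ℓ i j then w ℓ else + 0) ≡ weightedAdj w i j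
  ΣZ-joins w i j = ΣZ-search (λ ℓ → joins ℓ i j) w (joins-unique i j)

  weightedAdj-irrefl : ∀ w i → weightedAdj w i i ≡ + 0
  weightedAdj-irrefl w i = trans (sym (ΣZ-joins w i i)) (ΣZ-zero vanishes)
    where
    vanishes : ∀ ℓ → (if joins ℓ i i then w ℓ else + 0) ≡ + 0
    vanishes ℓ rewrite joins-irrefl ℓ i = refl

  joining-edge-endpoint : ∀ {ℓ i j u} → joins ℓ i j ≡ true →
                          u ≡ end₁ ℓ ⊎ u ≡ end₂ ℓ → u ≡ i ⊎ u ≡ j
  joining-edge-endpoint {ℓ} {i} {j} e u-end with joins⇒endpoints ℓ i j e | u-end
  ... | inj₁ (p , q) | inj₁ r = inj₁ (trans r (sym p))
  ... | inj₁ (p , q) | inj₂ r = inj₂ (trans r (sym q))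
  ... | inj₂ (p , q) | inj₁ r = inj₂ (trans r (sym q))
  ... | inj₂ (p , q) | inj₂ r = inj₁ (trans r (sym p))

  gram-entries : ∀ (f : Fin n → Fin n → Fin m → ℤ[i]) d a →
                 (∀ i ℓ → f i i ℓ ≡ ι (if incident i ℓ then d ℓ else + 0)) →
                 (∀ {i j} → ¬ i ≡ j → ∀ ℓ → f i j ℓ ≡ ι (if joins ℓ i j then a ℓ else + 0)) →
                 (λ i j → ΣG (f i j)) ≡ᴹ ιᴹ (diag (weightedDegree d) +ᴹ weightedAdj a)
  gram-entries f d a on-diagonal off-diagonal i j with i ≟ j
  ... | yes refl = begin
    ΣG (f i i)                               ≡⟨ ΣG-ι (on-diagonal i) ⟩
    ι (weightedDegree d i)                   ≡⟨ cong ι (+-identityʳ _) ⟨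
    ι (weightedDegree d i + + 0)             ≡⟨ cong (λ x → ι (weightedDegree d i + x)) (weightedAdj-irrefl a i) ⟨
    ι (weightedDegree d i + weightedAdj a i i) ∎
  ... | no i≢j = begin
    ΣG (f i j)                               ≡⟨ ΣG-ι (off-diagonal i≢j) ⟩
    ι (ΣZ (λ ℓ → if joins ℓ i j then a ℓ else + 0)) ≡⟨ cong ι (ΣZ-joins a i j) ⟩
    ι (weightedAdj a i j)                    ≡⟨ cong ι (+-identityˡ _) ⟨
    ι (+ 0 + weightedAdj a i j)              ∎

  weightedAdj-neg : ∀ w i j → weightedAdj (-_ ∘ w) i j ≡ - weightedAdj w i j
  weightedAdj-neg w i j with edge? i j
  ... | just _  = refl
  ... | nothing = refl

-- The products x y and x ȳ are handled at once: only their behaviour on 0 and under negation matters.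
module GramEntries
  (_⋆_ : ℤ[i] → ℤ[i] → ℤ[i])
  (⋆-zeroˡ : ∀ y → 0ᵍ ⋆ y ≡ 0ᵍ) (⋆-zeroʳ : ∀ x → x ⋆ 0ᵍ ≡ 0ᵍ)
  (⊖-⋆ : ∀ x y → (⊖ x) ⋆ y ≡ ⊖ (x ⋆ y)) (⋆-⊖ : ∀ x y → x ⋆ (⊖ y) ≡ ⊖ (x ⋆ y))
  where

  negateIf-⋆ : ∀ b c x y → negateIf b x ⋆ negateIf c y ≡ negateIf (b xor c) (x ⋆ y)
  negateIf-⋆ false false x y = refl
  negateIf-⋆ false true  x y = ⋆-⊖ x y
  negateIf-⋆ true  false x y = ⊖-⋆ x y
  negateIf-⋆ true  true  x y = begin
    (⊖ x) ⋆ (⊖ y) ≡⟨ ⊖-⋆ x (⊖ y) ⟩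
    ⊖ (x ⋆ (⊖ y)) ≡⟨ cong ⊖_ (⋆-⊖ x y) ⟩
    ⊖ ⊖ (x ⋆ y)   ≡⟨ ⊖-involutive (x ⋆ y) ⟩
    x ⋆ y         ∎

  module _ {n m} (G : SignedGraph n m) (w : Fin m → ℤ)
           (entry-⋆ : ∀ ℓ → SignedGraph.entry G ℓ ⋆ SignedGraph.entry G ℓ ≡ ι (w ℓ)) where
    open SignedGraph G

    M±-column : ∀ i j ℓ → M± i ℓ ⋆ M± j ℓ ≡ ι (if incident i ℓ ∧ incident j ℓ then w ℓ else + 0)
    M±-column i j ℓ with incident i ℓ | incident j ℓ
    ... | true  | true  = entry-⋆ ℓ
    ... | true  | false = ⋆-zeroʳ (entry ℓ)
    ... | false | _     = ⋆-zeroˡ _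

    M±-column-diag : ∀ i ℓ → M± i ℓ ⋆ M± i ℓ ≡ ι (if incident i ℓ then w ℓ else + 0)
    M±-column-diag i ℓ =
      trans (M±-column i i ℓ) (cong (λ b → ι (if b then w ℓ else + 0)) (∧-idem (incident i ℓ)))

    M±-column-off : ∀ {i j} → ¬ i ≡ j → ∀ ℓ → M± i ℓ ⋆ M± j ℓ ≡ ι (if joins ℓ i j then w ℓ else + 0)
    M±-column-off {i} {j} i≢j ℓ =
      trans (M±-column i j ℓ) (cong (λ b → ι (if b then w ℓ else + 0)) (incident∧incident≡joins graph ℓ i≢j))

    M±-gram : (λ i j → ΣG (λ ℓ → M± i ℓ ⋆ M± j ℓ))
              ≡ᴹ ιᴹ (diag (weightedDegree graph w) +ᴹ weightedAdj graph w)
    M±-gram = gram-entries graph _ w w M±-column-diag M±-column-off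

    module _ (N : Mat ℤ[i] n m) (oriented : IsOrientedNetIncidence N) where

      oriented-column-diag : ∀ i ℓ → N i ℓ ⋆ N i ℓ ≡ ι (if incident i ℓ then w ℓ else + 0)
      oriented-column-diag i ℓ with oriented ℓ
      ... | u , _ , N≡ = begin
        N i ℓ ⋆ N i ℓ                                    ≡⟨ cong₂ _⋆_ (N≡ i) (N≡ i) ⟩
        negateIf b (M± i ℓ) ⋆ negateIf b (M± i ℓ)        ≡⟨ negateIf-⋆ b b _ _ ⟩
        negateIf (b xor b) (M± i ℓ ⋆ M± i ℓ)             ≡⟨ cong (λ c → negateIf c (M± i ℓ ⋆ M± i ℓ)) (xor-same b) ⟩
        M± i ℓ ⋆ M± i ℓ                                  ≡⟨ M±-column-diag i ℓ ⟩
        ι (if incident i ℓ then w ℓ else + 0)            ∎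
        where b = does (i ≟ u)

      oriented-column-off : ∀ {i j} → ¬ i ≡ j → ∀ ℓ → N i ℓ ⋆ N j ℓ ≡ ι (if joins ℓ i j then - w ℓ else + 0)
      oriented-column-off {i} {j} i≢j ℓ with oriented ℓ
      ... | u , u-end , N≡ = begin
        N i ℓ ⋆ N j ℓ                                    ≡⟨ cong₂ _⋆_ (N≡ i) (N≡ j) ⟩
        negateIf bᵢ (M± i ℓ) ⋆ negateIf bⱼ (M± j ℓ)      ≡⟨ negateIf-⋆ bᵢ bⱼ _ _ ⟩
        negateIf (bᵢ xor bⱼ) (M± i ℓ ⋆ M± j ℓ)           ≡⟨ cong (negateIf (bᵢ xor bⱼ)) (M±-column-off i≢j ℓ) ⟩
        negateIf (bᵢ xor bⱼ) (ι (if joins ℓ i j then w ℓ else + 0)) ≡⟨ negated-edge-term ⟩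
        ι (if joins ℓ i j then - w ℓ else + 0)           ∎
        where
        bᵢ = does (i ≟ u)
        bⱼ = does (j ≟ u)
        negated-edge-term : negateIf (bᵢ xor bⱼ) (ι (if joins ℓ i j then w ℓ else + 0))
                            ≡ ι (if joins ℓ i j then - w ℓ else + 0)
        negated-edge-term with joins ℓ i j in e
        ... | true  rewrite exactly-one-equal i≢j (joining-edge-endpoint graph e u-end) = refl
        ... | false = negateIf-0ᵍ (bᵢ xor bⱼ)

      oriented-gram : (λ i j → ΣG (λ ℓ → N i ℓ ⋆ N j ℓ))
                      ≡ᴹ ιᴹ (diag (weightedDegree graph w) -ᴹ weightedAdj graph w)
      oriented-gram i j =
        trans (gram-entries graph _ w (-_ ∘ w) oriented-column-diag oriented-column-off i j)
              (cong (λ x → ι (diag (weightedDegree graph w) i j + x)) (weightedAdj-neg graph w i j))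

module Transpose = GramEntries _⊛_ (λ _ → refl) ⊛-zeroʳ ⊖-⊛ ⊛-⊖
module ConjTranspose =
  GramEntries (λ x y → x ⊛ conj y) (λ _ → refl) ⊛-zeroʳ (λ x y → ⊖-⊛ x (conj y)) (λ x y → ⊛-⊖ x (conj y))

module _ {n m} (G : SignedGraph n m) where
  open SignedGraph G

  A≡weightedAdj : A ≡ᴹ weightedAdj graph (sgn ∘ σ)
  A≡weightedAdj i j with edge? i j
  ... | just _  = refl
  ... | nothing = refl

  adj≡weightedAdj : adj ≡ᴹ weightedAdj graph (λ _ → + 1)
  adj≡weightedAdj i j with edge? i j
  ... | just _  = refl
  ... | nothing = refl

  adj≡∣A∣ : adj ≡ᴹ ∣ A ∣ᴹ
  adj≡∣A∣ i j with edge? i j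
  ... | nothing = refl
  ... | just ℓ with σ ℓ
  ...   | pos = refl
  ...   | neg = refl

  entry-⊛-entry : ∀ ℓ → entry ℓ ⊛ entry ℓ ≡ ι (sgn (σ ℓ))
  entry-⊛-entry ℓ with σ ℓ
  ... | pos = refl
  ... | neg = refl

  entry-⊛-conj-entry : ∀ ℓ → entry ℓ ⊛ conj (entry ℓ) ≡ ι (+ 1)
  entry-⊛-conj-entry ℓ with σ ℓ
  ... | pos = refl
  ... | neg = refl

  Q±-gram : ιᴹ Q± ≡ᴹ (M± · transpose M±)
  Q±-gram i j = sym (trans (Transpose.M±-gram G (sgn ∘ σ) entry-⊛-entry i j)
                           (cong (λ x → ι (D± i j + x)) (sym (A≡weightedAdj i j))))

  L±-gram : ∀ N → IsOrientedNetIncidence N → ιᴹ L± ≡ᴹ (N · transpose N)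
  L±-gram N oriented i j =
    sym (trans (Transpose.oriented-gram G (sgn ∘ σ) entry-⊛-entry N oriented i j)
               (cong (λ x → ι (D± i j - x)) (sym (A≡weightedAdj i j))))

  signlessLaplacian-gram : ιᴹ signlessLaplacian ≡ᴹ (M± · conjTranspose M±)
  signlessLaplacian-gram i j =
    sym (trans (ConjTranspose.M±-gram G (λ _ → + 1) entry-⊛-conj-entry i j)
               (cong (λ x → ι (D i j + x)) (sym (adj≡weightedAdj i j))))

  laplacian-gram : ∀ N → IsOrientedNetIncidence N → ιᴹ laplacian ≡ᴹ (N · conjTranspose N)
  laplacian-gram N oriented i j =
    sym (trans (ConjTranspose.oriented-gram G (λ _ → + 1) entry-⊛-conj-entry N oriented i j)
               (cong (λ x → ι (D i j - x)) (sym (adj≡weightedAdj i j))))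

open SignedGraph

mainTheorem5 : ∀ {n m} (G : SignedGraph n m) →
    (Q± G ≡ᴹ (D± G +ᴹ A G) × ιᴹ (Q± G) ≡ᴹ (M± G · transpose (M± G)))
    × (L± G ≡ᴹ (D± G -ᴹ A G)
    × (∀ N → IsOrientedNetIncidence G N → ιᴹ (L± G) ≡ᴹ (N · transpose N)))
    × (SimpleGraph.signlessLaplacian ∣ G ∣ᴳ ≡ᴹ (D G +ᴹ ∣ A G ∣ᴹ)
    × ιᴹ (SimpleGraph.signlessLaplacian ∣ G ∣ᴳ) ≡ᴹ (M± G · conjTranspose (M± G)))
    × (SimpleGraph.laplacian ∣ G ∣ᴳ ≡ᴹ (D G -ᴹ ∣ A G ∣ᴹ)
    × (∀ N → IsOrientedNetIncidence G N → ιᴹ (SimpleGraph.laplacian ∣ G ∣ᴳ) ≡ᴹ (N · conjTranspose N)))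
mainTheorem5 G =
    ((λ _ _ → refl) , Q±-gram G)
  , ((λ _ _ → refl) , L±-gram G)
  , ((λ i j → cong (λ x → D G i j + x) (adj≡∣A∣ G i j)) , signlessLaplacian-gram G)
  , ((λ i j → cong (λ x → D G i j - x) (adj≡∣A∣ G i j)) , laplacian-gram G)
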